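{- Let $N\geq 3$ be an integer. Then there exists a set $A\subseteq \mathbb{N}$ such that $R_2(A,n)=R_2(\mathbb{N}\setminus A,n)$ for all integers $n\geq 2N-1$, $|A\cap A_0|=+\infty$, $|A\cap B_0|=+\infty$, and $$R_2(A,n)< \frac{n+1}{2(N-1)}$$ for infinitely many integers $n$.
   Context: $\mathbb{N}$ denotes the set of nonnegative integers (including $0$). For $A\subseteq\mathbb{N}$ and an integer $n$, $R_2(A,n)$ denotes the number of solutions of $n=a+a'$ with $a,a'\in A$ and $a<a'$. For $a\in\mathbb{N}$, $D(a)$ is the number of ones in the binary representation of $a$ (with $D(0)=0$). $A_0$ is the set of all $a\in\mathbb{N}$ with $D(a)$ even (the Thue–Morse set), and $B_0=\mathbb{N}\setminus A_0$. -}

module Defs where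

open import Data.Nat using (ℕ; zero; suc; _+_; _*_; _∸_; _<ᵇ_; _≡ᵇ_)
open import Data.Nat.DivMod using (_%_; _/_)
open import Data.Bool using (Bool; true; false; _∧_; not)
open import Data.List using (List; length; filter; upTo)
open import Relation.Binary.PropositionalEquality using (_≡_)
open import Relation.Nullary.Decidable using (Dec; _because_)
open import Data.Bool.Properties using (_≟_)

Subset : Set
Subset = ℕ → Bool

compl : Subset → Subset
compl A a = not (A a)

-- number of ones in the binary representation, computed with fuel
-- (fuel a suffices, since a has at most a binary digits).
digitsOnes : ℕ → ℕ → ℕ
digitsOnes zero      _ = 0
digitsOnes (suc k)   a = a % 2 + digitsOnes k (a / 2)

D : ℕ → ℕ
D a = digitsOnes a a

A₀ : Subset
A₀ a = (D a % 2) ≡ᵇ 0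

B₀ : Subset
B₀ = compl A₀

-- R₂(A,n) = #{(a,a') : a,a' ∈ A, a < a', a + a' = n}
-- counted via the smaller element a (a' = n ∸ a, and a < a' iff 2a < n).
R₂ : Subset → ℕ → ℕ
R₂ A n = length (filter (λ a → (A a ∧ A (n ∸ a) ∧ ((a + a) <ᵇ n)) ≟ true) (upTo (suc n)))

{-# OPTIONS --safe #-}
module Submission where

-- Let P be the set of numbers whose binary expansion begins with that of p = 2N − 1, and let A be
-- the Thue–Morse set A₀ with membership flipped on P (0 and 1 are adjusted so that exactly N
-- elements of A lie below 2N). Then every pair {2y, 2y + 1} with y ≥ 1, y ≠ N − 1, contains exactly
-- one element of A, and 2y ∈ A ⟺ y ∈ A for y ≥ N. Inclusion–exclusion over the pairs {a, n − a}
-- gives R₂(A, n) − R₂(ℕ ∖ A, n) = |A ∩ [0, n]| − ⌈n/2⌉ − [n/2 ∈ A], which these two facts make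
-- vanish for n ≥ 2N − 1.
-- P is closed under doubling, so on doubling chains A agrees with A₀ outside P and with B₀ inside
-- P; hence A ∩ A₀ and A ∩ B₀ are infinite.
-- For n = 2^(2x+1) − 1 the numbers a and n − a have opposite Thue–Morse parity, so every
-- representation n = a + a' with a, a' ∈ A and 2 ≤ a < a' uses an element of P ∖ A₀. Below n there
-- are at most |P ∩ [0, (n+1)/2)| + 1 of those, while N (|P ∩ [0, 2^j)| + 1) ≤ 2^j for 2^j ≥ N and
-- |P ∩ [0, 2^j)| grows without bound; this gives 2(N − 1) R₂(A, n) < n + 1.

open import Defs
open import Data.Bool using (Bool; true; false; _∧_; _∨_; _xor_; not; T; if_then_else_)
open import Data.Bool.Properties
  using ( T-≡; T-∨; ∧-zeroʳ; ∧-identityʳ; not-involutive; not-distribˡ-xor; ¬-not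
        ; xor-identityʳ; xor-comm; xor-inverseʳ)
  renaming (_≟_ to _≟ᵇ_)
open import Data.Empty using (⊥-elim)
open import Data.List using ([_]; _∷ʳ_; _++_; length; filter; upTo)
open import Data.List.Properties using (upTo-∷ʳ; filter-++; length-++)
open import Data.Nat
  using ( ℕ; zero; suc; _+_; _*_; _∸_; _%_; _/_; _^_; _≤_; _<_; _<ᵇ_; _≤ᵇ_; _≡ᵇ_; z≤n; s≤s
        ; _≤′_; ≤′-refl; ≤′-step; >-nonZero)
open import Data.Nat.Properties
open import Data.Nat.DivMod
  using (m*n%n≡0; [m+kn]%n≡m%n; [m+n]%n≡m%n; m*n/n≡m; m/n<m; m/n*n≤m; m/n≤m; +-distrib-/-∣ʳ)
open import Data.Nat.Divisibility using (divides-refl)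
open import Data.Nat.Tactic.RingSolver using (solve-∀)
open import Algebra.Properties.CommutativeSemigroup +-commutativeSemigroup using (interchange)
open import Data.Product using (Σ; _×_; _,_)
open import Data.Sum as Sum using (_⊎_; inj₁; inj₂)
open import Function using (_∘_; Equivalence)
open import Relation.Binary.Definitions using (tri<; tri≈; tri>)
open import Relation.Binary.PropositionalEquality
  using (_≡_; _≢_; refl; sym; trans; cong; cong₂; subst; module ≡-Reasoning)
open import Relation.Nullary using (Dec; yes; no)

<ᵇ-true : ∀ {m n} → m < n → (m <ᵇ n) ≡ true
<ᵇ-true m<n = Equivalence.to T-≡ (<⇒<ᵇ m<n)

<ᵇ-false : ∀ {m n} → n ≤ m → (m <ᵇ n) ≡ false
<ᵇ-false {m} {n} n≤m with m <ᵇ n | <ᵇ⇒< m n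
... | true  | m<n = ⊥-elim (<⇒≱ (m<n _) n≤m)
... | false | _   = refl

≡ᵇ-refl : ∀ m → (m ≡ᵇ m) ≡ true
≡ᵇ-refl m = Equivalence.to T-≡ (≡⇒≡ᵇ m m refl)

≡ᵇ-false : ∀ {m n} → m ≢ n → (m ≡ᵇ n) ≡ false
≡ᵇ-false {m} {n} m≢n with m ≡ᵇ n | ≡ᵇ⇒≡ m n
... | true  | m≡n = ⊥-elim (m≢n (m≡n _))
... | false | _   = refl

data EvenOdd : ℕ → Set where
  even : ∀ b → EvenOdd (b * 2)
  odd  : ∀ b → EvenOdd (suc (b * 2))

evenOdd : ∀ n → EvenOdd n
evenOdd zero = even 0
evenOdd (suc n) with evenOdd n
... | even b = odd b
... | odd b  = even (suc b)

*2≡+ : ∀ m → m * 2 ≡ m + m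
*2≡+ = solve-∀

double-injective : ∀ {m n} → m + m ≡ n + n → m ≡ n
double-injective {m} {n} eq = *-cancelʳ-≡ m n 2 (trans (*2≡+ m) (trans eq (sym (*2≡+ n))))

*2≢1+*2 : ∀ m n → m * 2 ≢ suc (n * 2)
*2≢1+*2 m n eq = 0≢1+n (trans (sym (m*n%n≡0 m 2)) (trans (cong (_% 2) eq) ([m+kn]%n≡m%n 1 n 2)))

half-≤ : ∀ {a k} → a ≤ suc k → a / 2 ≤ k
half-≤ {zero}  _      = z≤n
half-≤ {suc a} a≤1+k = ≤-pred (≤-trans (m/n<m (suc a) 2 (s≤s (s≤s z≤n))) a≤1+k)

*2/2 : ∀ b → b * 2 / 2 ≡ b
*2/2 b = m*n/n≡m b 2

1+*2/2 : ∀ b → suc (b * 2) / 2 ≡ b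
1+*2/2 b = trans (+-distrib-/-∣ʳ 1 {d = 2} (divides-refl b)) (*2/2 b)

n<2^n : ∀ n → n < 2 ^ n
n<2^n zero    = s≤s z≤n
n<2^n (suc n) = +-mono-≤ (m^n>0 2 n) (≤-trans (n<2^n n) (≤-reflexive (sym (+-identityʳ (2 ^ n)))))

2m[c+3]<2[m+1][c+1] : ∀ m c → m * 2 ≤ c → 2 * m * (2 + (c + 1)) < suc m * (c + 1) * 2
2m[c+3]<2[m+1][c+1] m c 2m≤c =
  subst (λ c → 2 * m * (2 + (c + 1)) < suc m * (c + 1) * 2) (m+[n∸m]≡n 2m≤c) (gap (c ∸ m * 2))
  where
  expand : ∀ m q → suc m * (m * 2 + q + 1) * 2 ≡ 2 * m * (2 + (m * 2 + q + 1)) + suc q * 2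
  expand = solve-∀
  gap : ∀ q → 2 * m * (2 + (m * 2 + q + 1)) < suc m * (m * 2 + q + 1) * 2
  gap q = subst (2 * m * (2 + (m * 2 + q + 1)) <_) (sym (expand m q)) (m<m+n _ (s≤s z≤n))

toℕ : Bool → ℕ
toℕ false = 0
toℕ true  = 1

∑< : ℕ → (ℕ → ℕ) → ℕ
∑< zero    f = 0
∑< (suc n) f = ∑< n f + f n

count : (ℕ → Bool) → ℕ → ℕ
count f n = ∑< n (toℕ ∘ f)

_∩_ : (ℕ → Bool) → (ℕ → Bool) → ℕ → Bool
(f ∩ g) a = f a ∧ g a

∑<-cong : ∀ {f g} n → (∀ a → a < n → f a ≡ g a) → ∑< n f ≡ ∑< n g
∑<-cong zero    f≡g = refl
∑<-cong (suc n) f≡g = cong₂ _+_ (∑<-cong n (λ a a<n → f≡g a (m<n⇒m<1+n a<n))) (f≡g n ≤-refl)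

∑<-mono-≤ : ∀ {f g} n → (∀ a → a < n → f a ≤ g a) → ∑< n f ≤ ∑< n g
∑<-mono-≤ zero    f≤g = z≤n
∑<-mono-≤ (suc n) f≤g = +-mono-≤ (∑<-mono-≤ n (λ a a<n → f≤g a (m<n⇒m<1+n a<n))) (f≤g n ≤-refl)

∑<-+ : ∀ f g n → ∑< n (λ a → f a + g a) ≡ ∑< n f + ∑< n g
∑<-+ f g zero    = refl
∑<-+ f g (suc n) = trans (cong (_+ (f n + g n)) (∑<-+ f g n)) (interchange (∑< n f) (∑< n g) (f n) (g n))

∑<-front : ∀ f n → ∑< (suc n) f ≡ f 0 + ∑< n (f ∘ suc)
∑<-front f zero    = +-comm 0 (f 0)
∑<-front f (suc n) = trans (cong (_+ f (suc n)) (∑<-front f n)) (+-assoc (f 0) _ _)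

∑<-reverse : ∀ f n → ∑< (suc n) (λ a → f (n ∸ a)) ≡ ∑< (suc n) f
∑<-reverse f zero    = refl
∑<-reverse f (suc n) = begin
  ∑< (suc (suc n)) (λ a → f (suc n ∸ a))  ≡⟨ ∑<-front (λ a → f (suc n ∸ a)) (suc n) ⟩
  f (suc n) + ∑< (suc n) (λ a → f (n ∸ a)) ≡⟨ cong (f (suc n) +_) (∑<-reverse f n) ⟩
  f (suc n) + ∑< (suc n) f                 ≡⟨ +-comm (f (suc n)) _ ⟩
  ∑< (suc (suc n)) f                       ∎
  where open ≡-Reasoning

count-mono : ∀ {f g : ℕ → Bool} n → (∀ a → a < n → T (f a) → T (g a)) → count f n ≤ count g n
count-mono n f⇒g = ∑<-mono-≤ n (λ a a<n → toℕ-mono (f⇒g a a<n))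
  where
  toℕ-mono : ∀ {x y} → (T x → T y) → toℕ x ≤ toℕ y
  toℕ-mono {false}         _   = z≤n
  toℕ-mono {true}  {true}  _   = ≤-refl
  toℕ-mono {true}  {false} x⇒y = ⊥-elim (x⇒y _)

count-∨ : ∀ f g n → count (λ a → f a ∨ g a) n ≤ count f n + count g n
count-∨ f g n =
  ≤-trans (∑<-mono-≤ n (λ a _ → toℕ-∨ (f a) (g a))) (≤-reflexive (∑<-+ (toℕ ∘ f) (toℕ ∘ g) n))
  where
  toℕ-∨ : ∀ x y → toℕ (x ∨ y) ≤ toℕ x + toℕ y
  toℕ-∨ false y = ≤-refl
  toℕ-∨ true  y = m≤m+n 1 (toℕ y)

count-none : ∀ f n → (∀ a → a < n → f a ≡ false) → count f n ≡ 0
count-none f zero    _    = refl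
count-none f (suc n) none =
  cong₂ _+_ (count-none f n (λ a a<n → none a (m<n⇒m<1+n a<n))) (cong toℕ (none n ≤-refl))

count-only : ∀ f m n → m < n → (∀ a → a < n → a ≢ m → f a ≡ false) → count f n ≡ toℕ (f m)
count-only f m (suc n) m<1+n only with m ≟ n
... | yes refl = cong (_+ toℕ (f m)) (count-none f m (λ a a<m → only a (m<n⇒m<1+n a<m) (<⇒≢ a<m)))
... | no m≢n   = trans (cong₂ _+_ (count-only f m n (≤∧≢⇒< (≤-pred m<1+n) m≢n) (λ a a<n → only a (m<n⇒m<1+n a<n)))
                                  (cong toℕ (only n ≤-refl (m≢n ∘ sym))))
                       (+-identityʳ _)

count-true : ∀ n → count (λ _ → true) n ≡ n
count-true zero    = refl
count-true (suc n) = trans (cong (_+ 1) (count-true n)) (+-comm n 1)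

count-<2 : ∀ n → count (_<ᵇ 2) n ≤ 2
count-<2 zero                = z≤n
count-<2 (suc zero)          = s≤s z≤n
count-<2 (suc (suc zero))    = ≤-refl
count-<2 (suc (suc (suc n))) = ≤-trans (≤-reflexive (+-identityʳ _)) (count-<2 (suc (suc n)))

length-filter-upTo : ∀ f n → length (filter (λ a → f a ≟ᵇ true) (upTo n)) ≡ count f n
length-filter-upTo f zero    = refl
length-filter-upTo f (suc n) = begin
  length (filter f? (upTo (suc n)))                    ≡⟨ cong (length ∘ filter f?) (sym (upTo-∷ʳ n)) ⟩
  length (filter f? (upTo n ∷ʳ n))                     ≡⟨ cong length (filter-++ f? (upTo n) [ n ]) ⟩
  length (filter f? (upTo n) ++ filter f? [ n ])       ≡⟨ length-++ (filter f? (upTo n)) ⟩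
  length (filter f? (upTo n)) + length (filter f? [ n ])
    ≡⟨ cong₂ _+_ (length-filter-upTo f n) (length-filter-single n) ⟩
  count f (suc n)                                      ∎
  where
  open ≡-Reasoning
  f? : ∀ a → Dec (f a ≡ true)
  f? a = f a ≟ᵇ true
  length-filter-single : ∀ x → length (filter f? [ x ]) ≡ toℕ (f x)
  length-filter-single x with f x
  ... | true  = refl
  ... | false = refl

R₂-count : ∀ A n → R₂ A n ≡ count (λ a → A a ∧ A (n ∸ a) ∧ (a + a <ᵇ n)) (suc n)
R₂-count A n = length-filter-upTo _ (suc n)

count-pairs : ∀ f y → count f (suc y * 2) ≡ count f (y * 2) + (toℕ (f (y * 2)) + toℕ (f (suc (y * 2))))
count-pairs f y = +-assoc (count f (y * 2)) _ _

-- Representation functions of a set and of its complement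

module Halves (n : ℕ) where

  lower upper middle : ℕ → Bool
  lower  a = a + a <ᵇ n
  upper  a = lower (n ∸ a)
  middle a = a + a ≡ᵇ n

  # : (ℕ → Bool) → ℕ
  # f = count f (suc n)

  lower-upper-middle : ∀ a → a ≤ n → toℕ (lower a) + toℕ (upper a) + toℕ (middle a) ≡ 1
  lower-upper-middle a a≤n =
    subst (λ z → toℕ (a + a <ᵇ z) + toℕ (n ∸ a + (n ∸ a) <ᵇ z) + toℕ (a + a ≡ᵇ z) ≡ 1)
          (m+[n∸m]≡n a≤n) (split a (n ∸ a))
    where
    split : ∀ a e → toℕ (a + a <ᵇ a + e) + toℕ (e + e <ᵇ a + e) + toℕ (a + a ≡ᵇ a + e) ≡ 1
    split a e with <-cmp a e
    ... | tri< a<e _ _ rewrite <ᵇ-true (+-monoʳ-< a a<e) | <ᵇ-false (+-monoˡ-≤ e (<⇒≤ a<e))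
                             | ≡ᵇ-false (<⇒≢ a<e ∘ +-cancelˡ-≡ a a e) = refl
    ... | tri≈ _ refl _ rewrite <ᵇ-false (≤-refl {a + a}) | ≡ᵇ-refl (a + a) = refl
    ... | tri> _ _ e<a rewrite <ᵇ-false (+-monoʳ-≤ a (<⇒≤ e<a)) | <ᵇ-true (+-monoˡ-< e e<a)
                             | ≡ᵇ-false (<⇒≢ e<a ∘ sym ∘ +-cancelˡ-≡ a a e) = refl

  #-split : ∀ f → # (f ∩ lower) + # (f ∩ upper) + # (f ∩ middle) ≡ # f
  #-split f = begin
    # (f ∩ lower) + # (f ∩ upper) + # (f ∩ middle)
      ≡⟨ cong (_+ # (f ∩ middle)) (∑<-+ (toℕ ∘ (f ∩ lower)) (toℕ ∘ (f ∩ upper)) (suc n)) ⟨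
    ∑< (suc n) (λ a → toℕ ((f ∩ lower) a) + toℕ ((f ∩ upper) a)) + # (f ∩ middle)
      ≡⟨ ∑<-+ (λ a → toℕ ((f ∩ lower) a) + toℕ ((f ∩ upper) a)) (toℕ ∘ (f ∩ middle)) (suc n) ⟨
    ∑< (suc n) (λ a → toℕ ((f ∩ lower) a) + toℕ ((f ∩ upper) a) + toℕ ((f ∩ middle) a))
      ≡⟨ ∑<-cong (suc n) (λ a a≤n → restrict (f a) (lower-upper-middle a (≤-pred a≤n))) ⟩
    # f ∎
    where
    open ≡-Reasoning
    restrict : ∀ {l u m} x → toℕ l + toℕ u + toℕ m ≡ 1 → toℕ (x ∧ l) + toℕ (x ∧ u) + toℕ (x ∧ m) ≡ toℕ x
    restrict false _  = refl
    restrict true  eq = eq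

  #-reflect : ∀ f → # (λ a → f (n ∸ a) ∧ lower a) ≡ # (f ∩ upper)
  #-reflect f = trans (∑<-cong {g = λ a → toℕ (f (n ∸ a) ∧ upper (n ∸ a))} (suc n) involution)
                      (∑<-reverse (toℕ ∘ (f ∩ upper)) n)
    where
    involution : ∀ a → a < suc n → toℕ (f (n ∸ a) ∧ lower a) ≡ toℕ (f (n ∸ a) ∧ lower (n ∸ (n ∸ a)))
    involution a a≤n = cong (λ b → toℕ (f (n ∸ a) ∧ lower b)) (sym (m∸[m∸n]≡n (≤-pred a≤n)))

  #-lower : # lower + # lower + # middle ≡ suc n
  #-lower = begin
    # lower + # lower + # middle ≡⟨ cong (λ c → # lower + c + # middle) (#-reflect (λ _ → true)) ⟩
    # lower + # upper + # middle ≡⟨ #-split (λ _ → true) ⟩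
    # (λ _ → true)               ≡⟨ count-true (suc n) ⟩
    suc n                        ∎
    where open ≡-Reasoning

  -- Inclusion–exclusion on each pair {a, n ∸ a} with a the lower summand.
  R₂-+-#lower : ∀ A → R₂ A n + # lower ≡ R₂ (compl A) n + (# (A ∩ lower) + # (A ∩ upper))
  R₂-+-#lower A = begin
    R₂ A n + # lower
      ≡⟨ cong (_+ # lower) (R₂-count A n) ⟩
    # (both A) + # lower
      ≡⟨ ∑<-+ (toℕ ∘ both A) (toℕ ∘ lower) (suc n) ⟨
    ∑< (suc n) (λ a → toℕ (both A a) + toℕ (lower a))
      ≡⟨ ∑<-cong (suc n) (λ a _ → pointwise (A a) (A (n ∸ a)) (lower a)) ⟩
    ∑< (suc n) (λ a → toℕ (both (compl A) a) + (toℕ (A a ∧ lower a) + toℕ (A (n ∸ a) ∧ lower a)))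
      ≡⟨ ∑<-+ (toℕ ∘ both (compl A)) (λ a → toℕ (A a ∧ lower a) + toℕ (A (n ∸ a) ∧ lower a)) (suc n) ⟩
    # (both (compl A)) + ∑< (suc n) (λ a → toℕ (A a ∧ lower a) + toℕ (A (n ∸ a) ∧ lower a))
      ≡⟨ cong₂ _+_ (R₂-count (compl A) n) (sym (∑<-+ (toℕ ∘ (A ∩ lower)) (λ a → toℕ (A (n ∸ a) ∧ lower a)) (suc n))) ⟨
    R₂ (compl A) n + (# (A ∩ lower) + # (λ a → A (n ∸ a) ∧ lower a))
      ≡⟨ cong (λ c → R₂ (compl A) n + (# (A ∩ lower) + c)) (#-reflect A) ⟩
    R₂ (compl A) n + (# (A ∩ lower) + # (A ∩ upper)) ∎
    where
    open ≡-Reasoning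
    both : Subset → ℕ → Bool
    both B a = B a ∧ B (n ∸ a) ∧ lower a
    pointwise : ∀ x y l → toℕ (x ∧ y ∧ l) + toℕ l ≡ toℕ (not x ∧ not y ∧ l) + (toℕ (x ∧ l) + toℕ (y ∧ l))
    pointwise true  true  false = refl
    pointwise true  false false = refl
    pointwise false true  false = refl
    pointwise false false false = refl
    pointwise true  true  true  = refl
    pointwise true  false true  = refl
    pointwise false true  true  = refl
    pointwise false false true  = refl

  R₂-compl-identity : ∀ A → R₂ A n + (# lower + # (A ∩ middle)) ≡ R₂ (compl A) n + # A
  R₂-compl-identity A = begin
    R₂ A n + (# lower + # (A ∩ middle))                               ≡⟨ +-assoc (R₂ A n) _ _ ⟨
    R₂ A n + # lower + # (A ∩ middle)                                 ≡⟨ cong (_+ # (A ∩ middle)) (R₂-+-#lower A) ⟩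
    R₂ (compl A) n + (# (A ∩ lower) + # (A ∩ upper)) + # (A ∩ middle) ≡⟨ +-assoc (R₂ (compl A) n) _ _ ⟩
    R₂ (compl A) n + (# (A ∩ lower) + # (A ∩ upper) + # (A ∩ middle)) ≡⟨ cong (R₂ (compl A) n +_) (#-split A) ⟩
    R₂ (compl A) n + # A                                              ∎
    where open ≡-Reasoning

  R₂-≤-cover : ∀ A Q → (∀ a → a + a < n → T (A a) → T (A (n ∸ a)) → T (Q a) ⊎ T (Q (n ∸ a)))
               → R₂ A n ≤ # Q
  R₂-≤-cover A Q cover = begin
    R₂ A n
      ≡⟨ R₂-count A n ⟩
    # (λ a → A a ∧ A (n ∸ a) ∧ lower a)
      ≤⟨ ∑<-mono-≤ (suc n) (λ a _ → pointwise (A a) (A (n ∸ a)) (lower a) (Q a) (Q (n ∸ a))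
                                               (cover a ∘ <ᵇ⇒< (a + a) n)) ⟩
    ∑< (suc n) (λ a → toℕ (Q a ∧ lower a) + toℕ (Q (n ∸ a) ∧ lower a))
      ≡⟨ ∑<-+ (toℕ ∘ (Q ∩ lower)) (λ a → toℕ (Q (n ∸ a) ∧ lower a)) (suc n) ⟩
    # (Q ∩ lower) + # (λ a → Q (n ∸ a) ∧ lower a)
      ≡⟨ cong (# (Q ∩ lower) +_) (#-reflect Q) ⟩
    # (Q ∩ lower) + # (Q ∩ upper)
      ≤⟨ m≤m+n _ (# (Q ∩ middle)) ⟩
    # (Q ∩ lower) + # (Q ∩ upper) + # (Q ∩ middle)
      ≡⟨ #-split Q ⟩
    # Q ∎
    where
    open ≤-Reasoning
    pointwise : ∀ x y l q r → (T l → T x → T y → T q ⊎ T r) → toℕ (x ∧ y ∧ l) ≤ toℕ (q ∧ l) + toℕ (r ∧ l)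
    pointwise false _     _     _     _     _ = z≤n
    pointwise true  false _     _     _     _ = z≤n
    pointwise true  true  false _     _     _ = z≤n
    pointwise true  true  true  true  _     _ = s≤s z≤n
    pointwise true  true  true  false true  _ = s≤s z≤n
    pointwise true  true  true  false false c with c _ _ _
    ... | inj₁ ()
    ... | inj₂ ()

R₂-compl-odd : ∀ A y → R₂ A (suc (y * 2)) + suc y ≡ R₂ (compl A) (suc (y * 2)) + count A (suc y * 2)
R₂-compl-odd A y = begin
  R₂ A n + suc y
    ≡⟨ cong (R₂ A n +_) (trans (cong₂ _+_ #lower≡1+y #middle≡0) (+-identityʳ (suc y))) ⟨
  R₂ A n + (# lower + # (A ∩ middle))
    ≡⟨ R₂-compl-identity A ⟩
  R₂ (compl A) n + count A (suc y * 2) ∎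
  where
  open ≡-Reasoning
  n : ℕ
  n = suc (y * 2)
  open Halves n
  no-middle : ∀ f a → (f ∩ middle) a ≡ false
  no-middle f a = trans (cong (f a ∧_) (≡ᵇ-false (λ eq → *2≢1+*2 a y (trans (*2≡+ a) eq)))) (∧-zeroʳ (f a))
  #middle≡0 : ∀ {f} → # (f ∩ middle) ≡ 0
  #middle≡0 {f} = count-none (f ∩ middle) (suc n) (λ a _ → no-middle f a)
  #lower≡1+y : # lower ≡ suc y
  #lower≡1+y = double-injective (begin
    # lower + # lower            ≡⟨ +-identityʳ _ ⟨
    # lower + # lower + 0        ≡⟨ cong (# lower + # lower +_) (#middle≡0 {λ _ → true}) ⟨
    # lower + # lower + # middle ≡⟨ #-lower ⟩
    suc y * 2                    ≡⟨ *2≡+ (suc y) ⟩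
    suc y + suc y                ∎)

R₂-compl-even : ∀ A y → R₂ A (y * 2) + (y + toℕ (A y)) ≡ R₂ (compl A) (y * 2) + count A (suc (y * 2))
R₂-compl-even A y = begin
  R₂ A n + (y + toℕ (A y))                   ≡⟨ cong (R₂ A n +_) (cong₂ _+_ #lower≡y (#middle A)) ⟨
  R₂ A n + (# lower + # (A ∩ middle))        ≡⟨ R₂-compl-identity A ⟩
  R₂ (compl A) n + count A (suc (y * 2))     ∎
  where
  open ≡-Reasoning
  n : ℕ
  n = y * 2
  open Halves n
  middle-only-y : ∀ f a → a ≢ y → (f ∩ middle) a ≡ false
  middle-only-y f a a≢y =
    trans (cong (f a ∧_) (≡ᵇ-false (a≢y ∘ double-injective ∘ (λ eq → trans eq (*2≡+ y))))) (∧-zeroʳ (f a))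
  middle-y : middle y ≡ true
  middle-y = trans (cong (y + y ≡ᵇ_) (*2≡+ y)) (≡ᵇ-refl (y + y))
  #middle : ∀ f → # (f ∩ middle) ≡ toℕ (f y)
  #middle f = trans (count-only (f ∩ middle) y (suc n) (s≤s (m≤m*n y 2)) (λ a _ → middle-only-y f a))
                    (cong toℕ (trans (cong (f y ∧_) middle-y) (∧-identityʳ (f y))))
  #lower≡y : # lower ≡ y
  #lower≡y = double-injective (+-cancelʳ-≡ 1 _ _ (begin
    # lower + # lower + 1        ≡⟨ cong (# lower + # lower +_) (#middle (λ _ → true)) ⟨
    # lower + # lower + # middle ≡⟨ #-lower ⟩
    suc (y * 2)                  ≡⟨ cong suc (*2≡+ y) ⟩
    suc (y + y)                  ≡⟨ +-comm 1 (y + y) ⟩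
    y + y + 1                    ∎))

R₂-compl-balanced : ∀ A n₀ → (∀ y → n₀ ≤ y → count A (y * 2) ≡ y) → (∀ y → n₀ ≤ y → A (y * 2) ≡ A y) →
                    ∀ n → n₀ * 2 ≤ suc n → R₂ A n ≡ R₂ (compl A) n
R₂-compl-balanced A n₀ count-A double-A n n₀*2≤1+n with evenOdd n
... | odd y  = +-cancelʳ-≡ (suc y) _ _
                 (trans (R₂-compl-odd A y) (cong (R₂ (compl A) (suc (y * 2)) +_) (count-A (suc y) n₀≤1+y)))
  where
  n₀≤1+y : n₀ ≤ suc y
  n₀≤1+y = *-cancelʳ-≤ n₀ (suc y) 2 n₀*2≤1+n
... | even y = +-cancelʳ-≡ (y + toℕ (A y)) _ _
                 (trans (R₂-compl-even A y) (cong (R₂ (compl A) (y * 2) +_)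
                   (cong₂ _+_ (count-A y n₀≤y) (cong toℕ (double-A y n₀≤y)))))
  where
  n₀≤y : n₀ ≤ y
  n₀≤y = ≤-pred (*-cancelʳ-< _ n₀ (suc y) (s≤s n₀*2≤1+n))

-- The Thue–Morse set

digitsOnes-zero : ∀ k → digitsOnes k 0 ≡ 0
digitsOnes-zero zero    = refl
digitsOnes-zero (suc k) = digitsOnes-zero k

digitsOnes-fuel : ∀ {k l} a → a ≤ k → a ≤ l → digitsOnes k a ≡ digitsOnes l a
digitsOnes-fuel {k}     {l}     zero    _    _    = trans (digitsOnes-zero k) (sym (digitsOnes-zero l))
digitsOnes-fuel {suc k} {suc l} (suc a) a≤1+k a≤1+l =
  cong (suc a % 2 +_) (digitsOnes-fuel (suc a / 2) (half-≤ a≤1+k) (half-≤ a≤1+l))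

D-step : ∀ a → D (suc a) ≡ suc a % 2 + D (suc a / 2)
D-step a = cong (suc a % 2 +_) (digitsOnes-fuel {a} (suc a / 2) (half-≤ ≤-refl) ≤-refl)

D-double : ∀ b → D (b * 2) ≡ D b
D-double zero    = refl
D-double (suc b) = trans (D-step (suc (b * 2))) (cong₂ _+_ (m*n%n≡0 (suc b) 2) (cong D (*2/2 (suc b))))

D-double+1 : ∀ b → D (suc (b * 2)) ≡ suc (D b)
D-double+1 b = trans (D-step (b * 2)) (cong₂ _+_ ([m+kn]%n≡m%n 1 b 2) (cong D (1+*2/2 b)))

-- c is the complement of a among the j binary digits of 2 ^ j ∸ 1.
D-complement : ∀ j a c → suc (a + c) ≡ 2 ^ j → D a + D c ≡ j
D-complement zero    zero    zero    _  = refl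
D-complement (suc j) a c eq with evenOdd a | evenOdd c | trans eq (*-comm 2 (2 ^ j))
... | even b | even d | eq′ = ⊥-elim (*2≢1+*2 (2 ^ j) (b + d) (sym (trans (cong suc (*-distribʳ-+ 2 b d)) eq′)))
... | odd b  | odd d  | eq′ = ⊥-elim (*2≢1+*2 (2 ^ j) (suc (b + d)) (sym (trans (sym (odd+odd b d)) eq′)))
  where
  odd+odd : ∀ b d → suc (suc (b * 2) + suc (d * 2)) ≡ suc (suc (b + d) * 2)
  odd+odd = solve-∀
... | even b | odd d  | eq′ = begin
  D (b * 2) + D (suc (d * 2)) ≡⟨ cong₂ _+_ (D-double b) (D-double+1 d) ⟩
  D b + suc (D d)             ≡⟨ +-suc (D b) (D d) ⟩
  suc (D b + D d)             ≡⟨ cong suc (D-complement j b d (*-cancelʳ-≡ _ _ 2 (trans (sym (even+odd b d)) eq′))) ⟩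
  suc j                       ∎
  where
  open ≡-Reasoning
  even+odd : ∀ b d → suc (b * 2 + suc (d * 2)) ≡ suc (b + d) * 2
  even+odd = solve-∀
... | odd b  | even d | eq′ = begin
  D (suc (b * 2)) + D (d * 2) ≡⟨ cong₂ _+_ (D-double+1 b) (D-double d) ⟩
  suc (D b + D d)             ≡⟨ cong suc (D-complement j b d (*-cancelʳ-≡ _ _ 2 (trans (sym (odd+even b d)) eq′))) ⟩
  suc j                       ∎
  where
  open ≡-Reasoning
  odd+even : ∀ b d → suc (suc (b * 2) + d * 2) ≡ suc (b + d) * 2
  odd+even = solve-∀

isEven : ℕ → Bool
isEven n = n % 2 ≡ᵇ 0

isEven-suc : ∀ n → isEven (suc n) ≡ not (isEven n)
isEven-suc zero          = refl
isEven-suc (suc zero)    = refl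
isEven-suc (suc (suc n)) = trans (isEven-2+ (suc n)) (trans (isEven-suc n) (cong not (sym (isEven-2+ n))))
  where
  isEven-2+ : ∀ n → isEven (suc (suc n)) ≡ isEven n
  isEven-2+ n = cong (_≡ᵇ 0) (trans (cong (_% 2) (+-comm 2 n)) ([m+n]%n≡m%n n 2))

isEven-+ : ∀ m n → isEven (m + n) ≡ not (isEven m xor isEven n)
isEven-+ zero    n = sym (not-involutive (isEven n))
isEven-+ (suc m) n = begin
  isEven (suc (m + n))                ≡⟨ isEven-suc (m + n) ⟩
  not (isEven (m + n))                ≡⟨ cong not (isEven-+ m n) ⟩
  not (not (isEven m xor isEven n))   ≡⟨ cong not (not-distribˡ-xor (isEven m) (isEven n)) ⟩
  not (not (isEven m) xor isEven n)   ≡⟨ cong (λ e → not (e xor isEven n)) (sym (isEven-suc m)) ⟩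
  not (isEven (suc m) xor isEven n)   ∎
  where open ≡-Reasoning

A₀-double : ∀ b → A₀ (b * 2) ≡ A₀ b
A₀-double b = cong isEven (D-double b)

A₀-double+1 : ∀ b → A₀ (suc (b * 2)) ≡ not (A₀ b)
A₀-double+1 b = trans (cong isEven (D-double+1 b)) (isEven-suc (D b))

A₀-complement : ∀ x a c → suc (a + c) ≡ 2 ^ suc (x * 2) → A₀ c ≡ not (A₀ a)
A₀-complement x a c eq = xnor-false (A₀ a) (A₀ c) (begin
  not (A₀ a xor A₀ c)       ≡⟨ isEven-+ (D a) (D c) ⟨
  isEven (D a + D c)        ≡⟨ cong isEven (D-complement (suc (x * 2)) a c eq) ⟩
  isEven (suc (x * 2))      ≡⟨ isEven-suc (x * 2) ⟩
  not (isEven (x * 2))      ≡⟨ cong (λ r → not (r ≡ᵇ 0)) (m*n%n≡0 x 2) ⟩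
  false                     ∎)
  where
  open ≡-Reasoning
  xnor-false : ∀ x y → not (x xor y) ≡ false → y ≡ not x
  xnor-false true  false _ = refl
  xnor-false false true  _ = refl

A₀-pair : ∀ t b → Σ ℕ λ a → a / 2 ≡ t × A₀ a ≡ b
A₀-pair t b with A₀ t ≟ᵇ b
... | yes A₀t≡b = t * 2 , *2/2 t , trans (A₀-double t) A₀t≡b
... | no  A₀t≢b = suc (t * 2) , 1+*2/2 t , trans (A₀-double+1 t) (sym (¬-not (A₀t≢b ∘ sym)))

-- Binary prefixes

-- startsWith p a: the binary expansion of a begins with that of p (for p ≥ 1). Each step drops the
-- last binary digit of a, so fuel a suffices.
startsWithFuel : ℕ → ℕ → ℕ → Bool
startsWithFuel p zero    a = a ≡ᵇ p
startsWithFuel p (suc k) a = if a ≤ᵇ p then a ≡ᵇ p else startsWithFuel p k (a / 2)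

startsWith : ℕ → ℕ → Bool
startsWith p a = startsWithFuel p a a

startsWithFuel-irrelevant : ∀ {p k l} a → a ≤ k → a ≤ l → startsWithFuel p k a ≡ startsWithFuel p l a
startsWithFuel-irrelevant {p} {k} {l} zero _ _ = trans (at-zero k) (sym (at-zero l))
  where
  at-zero : ∀ k → startsWithFuel p k 0 ≡ (0 ≡ᵇ p)
  at-zero zero    = refl
  at-zero (suc k) = refl
startsWithFuel-irrelevant {p} {suc k} {suc l} (suc a) a≤1+k a≤1+l with a <ᵇ p
... | true  = refl
... | false = startsWithFuel-irrelevant (suc a / 2) (half-≤ a≤1+k) (half-≤ a≤1+l)

startsWith-≤ : ∀ {p} a → a ≤ p → startsWith p a ≡ (a ≡ᵇ p)
startsWith-≤ zero    _   = refl
startsWith-≤ (suc a) a<p rewrite <ᵇ-true a<p = refl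

startsWith-half : ∀ {p a} → p < a → startsWith p a ≡ startsWith p (a / 2)
startsWith-half {p} {suc a} p<1+a rewrite <ᵇ-false (≤-pred p<1+a) =
  startsWithFuel-irrelevant {k = a} (suc a / 2) (half-≤ ≤-refl) ≤-refl

startsWith-double : ∀ p y → p < y * 2 → startsWith p (y * 2) ≡ startsWith p y
startsWith-double p y p<2y = trans (startsWith-half p<2y) (cong (startsWith p) (*2/2 y))

startsWith-double+1 : ∀ p y → p < y * 2 → startsWith p (suc (y * 2)) ≡ startsWith p y
startsWith-double+1 p y p<2y = trans (startsWith-half (m<n⇒m<1+n p<2y)) (cong (startsWith p) (1+*2/2 y))

startsWith-*2^ : ∀ p q → p < q * 2 → ∀ j → startsWith p (q * 2 ^ j) ≡ startsWith p q
startsWith-*2^ p q p<2q zero    = cong (startsWith p) (*-identityʳ q)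
startsWith-*2^ p q p<2q (suc j) = begin
  startsWith p (q * (2 * 2 ^ j)) ≡⟨ cong (startsWith p) (reassoc q (2 ^ j)) ⟩
  startsWith p (q * 2 ^ j * 2)   ≡⟨ startsWith-double p (q * 2 ^ j) (<-≤-trans p<2q (*-monoˡ-≤ 2 q≤q*2^j)) ⟩
  startsWith p (q * 2 ^ j)       ≡⟨ startsWith-*2^ p q p<2q j ⟩
  startsWith p q                 ∎
  where
  open ≡-Reasoning
  reassoc : ∀ q r → q * (2 * r) ≡ q * r * 2
  reassoc = solve-∀
  q≤q*2^j : q ≤ q * 2 ^ j
  q≤q*2^j = m≤m*n q (2 ^ j) {{m^n≢0 2 j}}

startsWith-odd-pair : ∀ m y → y ≢ m → startsWith (suc (m * 2)) (suc (y * 2)) ≡ startsWith (suc (m * 2)) (y * 2)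
startsWith-odd-pair m y y≢m with <-cmp y m
... | tri< y<m _ _ = begin
  startsWith p (suc (y * 2)) ≡⟨ startsWith-≤ (suc (y * 2)) (m≤n⇒m≤1+n 2y+1≤2m) ⟩
  (suc (y * 2) ≡ᵇ p)         ≡⟨ ≡ᵇ-false (y≢m ∘ *-cancelʳ-≡ y m 2 ∘ suc-injective) ⟩
  false                      ≡⟨ ≡ᵇ-false (*2≢1+*2 y m) ⟨
  (y * 2 ≡ᵇ p)               ≡⟨ startsWith-≤ (y * 2) (≤-trans (n≤1+n _) (m≤n⇒m≤1+n 2y+1≤2m)) ⟨
  startsWith p (y * 2)       ∎
  where
  open ≡-Reasoning
  p : ℕ
  p = suc (m * 2)
  2y+1≤2m : suc (y * 2) ≤ m * 2
  2y+1≤2m = ≤-trans (n≤1+n _) (*-monoˡ-≤ 2 y<m)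
... | tri≈ _ y≡m _ = ⊥-elim (y≢m y≡m)
... | tri> _ _ m<y = trans (startsWith-double+1 _ y 2m+1<2y) (sym (startsWith-double _ y 2m+1<2y))
  where
  2m+1<2y : suc (m * 2) < y * 2
  2m+1<2y = *-monoˡ-≤ 2 m<y

-- The set A

module Construction (k : ℕ) where

  m N p : ℕ
  m = suc k
  N = suc m
  p = suc (m * 2)

  P : ℕ → Bool
  P = startsWith p

  -- The choice made for 0 and 1 puts exactly N elements of A below 2N.
  A : Subset
  A a = if a <ᵇ 2 then not (A₀ m) else A₀ a xor P a

  N≤m*2 : N ≤ m * 2
  N≤m*2 = s≤s (s≤s (m≤m*n k 2))

  N≤p : N ≤ p
  N≤p = m≤n⇒m≤1+n N≤m*2

  N≤⇒p<*2 : ∀ {y} → N ≤ y → p < y * 2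
  N≤⇒p<*2 N≤y = *-monoˡ-≤ 2 N≤y

  P-double : ∀ y → N ≤ y → P (y * 2) ≡ P y
  P-double y N≤y = startsWith-double p y (N≤⇒p<*2 N≤y)

  P-double+1 : ∀ y → N ≤ y → P (suc (y * 2)) ≡ P y
  P-double+1 y N≤y = startsWith-double+1 p y (N≤⇒p<*2 N≤y)

  P-below : ∀ a → a < p → P a ≡ false
  P-below a a<p = trans (startsWith-≤ a (<⇒≤ a<p)) (≡ᵇ-false (<⇒≢ a<p))

  P-p : P p ≡ true
  P-p = trans (startsWith-≤ p ≤-refl) (≡ᵇ-refl p)

  A-≥2 : ∀ a → 2 ≤ a → A a ≡ A₀ a xor P a
  A-≥2 a 2≤a rewrite <ᵇ-false 2≤a = refl

  2≤*2 : ∀ {y} → 1 ≤ y → 2 ≤ y * 2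
  2≤*2 1≤y = *-monoˡ-≤ 2 1≤y

  A-double : ∀ y → N ≤ y → A (y * 2) ≡ A y
  A-double y N≤y = begin
    A (y * 2)                ≡⟨ A-≥2 (y * 2) (2≤*2 (≤-trans (s≤s z≤n) N≤y)) ⟩
    A₀ (y * 2) xor P (y * 2) ≡⟨ cong₂ _xor_ (A₀-double y) (P-double y N≤y) ⟩
    A₀ y xor P y             ≡⟨ A-≥2 y (≤-trans (s≤s (s≤s z≤n)) N≤y) ⟨
    A y                      ∎
    where open ≡-Reasoning

  A-pair : ∀ y → 1 ≤ y → y ≢ m → toℕ (A (y * 2)) + toℕ (A (suc (y * 2))) ≡ 1
  A-pair y 1≤y y≢m = begin
    toℕ (A (y * 2)) + toℕ (A (suc (y * 2)))
      ≡⟨ cong₂ (λ u v → toℕ u + toℕ v) (A-≥2 (y * 2) (2≤*2 1≤y)) (A-≥2 (suc (y * 2)) (m≤n⇒m≤1+n (2≤*2 1≤y))) ⟩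
    toℕ (A₀ (y * 2) xor P (y * 2)) + toℕ (A₀ (suc (y * 2)) xor P (suc (y * 2)))
      ≡⟨ cong₂ (λ u v → toℕ (u xor P (y * 2)) + toℕ (v xor P (suc (y * 2)))) (A₀-double y) (A₀-double+1 y) ⟩
    toℕ (A₀ y xor P (y * 2)) + toℕ (not (A₀ y) xor P (suc (y * 2)))
      ≡⟨ cong (λ v → toℕ (A₀ y xor P (y * 2)) + toℕ (not (A₀ y) xor v)) (startsWith-odd-pair m y y≢m) ⟩
    toℕ (A₀ y xor P (y * 2)) + toℕ (not (A₀ y) xor P (y * 2)) ≡⟨ complementary (A₀ y) (P (y * 2)) ⟩
    1 ∎
    where
    open ≡-Reasoning
    complementary : ∀ x q → toℕ (x xor q) + toℕ (not x xor q) ≡ 1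
    complementary true  true  = refl
    complementary true  false = refl
    complementary false true  = refl
    complementary false false = refl

  count-A-initial : ∀ t → t ≤ k → count A (suc t * 2) ≡ toℕ (not (A₀ m)) + toℕ (not (A₀ m)) + t
  count-A-initial zero    _     = sym (+-identityʳ _)
  count-A-initial (suc t) 1+t≤k = begin
    count A (suc (suc t) * 2)                                 ≡⟨ count-pairs A (suc t) ⟩
    count A (suc t * 2) + (toℕ (A (suc t * 2)) + toℕ (A (suc (suc t * 2))))
      ≡⟨ cong₂ _+_ (count-A-initial t (≤-trans (n≤1+n t) 1+t≤k)) (A-pair (suc t) (s≤s z≤n) (<⇒≢ (s≤s 1+t≤k))) ⟩
    c + c + t + 1                                             ≡⟨ +-assoc (c + c) t 1 ⟩
    c + c + (t + 1)                                           ≡⟨ cong (c + c +_) (+-comm t 1) ⟩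
    c + c + suc t                                             ∎
    where
    open ≡-Reasoning
    c : ℕ
    c = toℕ (not (A₀ m))

  count-A-2N : count A (N * 2) ≡ N
  count-A-2N = begin
    count A (N * 2)
      ≡⟨ count-pairs A m ⟩
    count A (m * 2) + (toℕ (A (m * 2)) + toℕ (A p))
      ≡⟨ cong₂ _+_ (count-A-initial k ≤-refl) (cong₂ (λ u v → toℕ u + toℕ v) A-2m A-p) ⟩
    toℕ (not (A₀ m)) + toℕ (not (A₀ m)) + k + (toℕ (A₀ m) + toℕ (A₀ m))
      ≡⟨ balance (A₀ m) ⟩
    N ∎
    where
    open ≡-Reasoning
    A-2m : A (m * 2) ≡ A₀ m
    A-2m = begin
      A (m * 2)                ≡⟨ A-≥2 (m * 2) (s≤s (s≤s z≤n)) ⟩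
      A₀ (m * 2) xor P (m * 2) ≡⟨ cong₂ _xor_ (A₀-double m) (P-below (m * 2) ≤-refl) ⟩
      A₀ m xor false           ≡⟨ xor-identityʳ (A₀ m) ⟩
      A₀ m                     ∎
    A-p : A p ≡ A₀ m
    A-p = begin
      A p                      ≡⟨ A-≥2 p (s≤s (s≤s z≤n)) ⟩
      A₀ p xor P p             ≡⟨ cong₂ _xor_ (A₀-double+1 m) P-p ⟩
      not (A₀ m) xor true      ≡⟨ xor-comm (not (A₀ m)) true ⟩
      not (not (A₀ m))         ≡⟨ not-involutive (A₀ m) ⟩
      A₀ m                     ∎
    balance : ∀ b → toℕ (not b) + toℕ (not b) + k + (toℕ b + toℕ b) ≡ N
    balance true  = +-comm k 2
    balance false = cong (suc ∘ suc) (+-identityʳ k)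

  count-A : ∀ y → N ≤ y → count A (y * 2) ≡ y
  count-A _ N≤y = from-2N (≤⇒≤′ N≤y)
    where
    from-2N : ∀ {y} → N ≤′ y → count A (y * 2) ≡ y
    from-2N ≤′-refl             = count-A-2N
    from-2N (≤′-step {y} N≤′y) = begin
      count A (suc y * 2)                                  ≡⟨ count-pairs A y ⟩
      count A (y * 2) + (toℕ (A (y * 2)) + toℕ (A (suc (y * 2))))
        ≡⟨ cong₂ _+_ (from-2N N≤′y) (A-pair y (≤-trans (s≤s z≤n) (≤′⇒≤ N≤′y)) (<⇒≢ (≤′⇒≤ N≤′y) ∘ sym)) ⟩
      y + 1                                                ≡⟨ +-comm y 1 ⟩
      suc y                                                ∎
      where open ≡-Reasoning

  R₂-A-compl : ∀ n → 2 * N ∸ 1 ≤ n → R₂ A n ≡ R₂ (compl A) n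
  R₂-A-compl n 2N-1≤n =
    R₂-compl-balanced A N count-A A-double n (subst (_≤ suc n) (sym (*-comm N 2)) (s≤s 2N-1≤n))

  A-via-half : ∀ a → N ≤ a / 2 → A a ≡ A₀ a xor P (a / 2)
  A-via-half a N≤a/2 =
    trans (A-≥2 a (≤-trans (s≤s (s≤s z≤n)) (<⇒≤ p<a))) (cong (A₀ a xor_) (startsWith-half p<a))
    where
    p<a : p < a
    p<a = <-≤-trans (N≤⇒p<*2 N≤a/2) (m/n*n≤m a 2)

  A-unbounded-with-A₀-value : ∀ v q → N ≤ q → P q ≡ not v →
                              ∀ b → Σ ℕ λ a → b ≤ a × A a ≡ true × A₀ a ≡ v
  A-unbounded-with-A₀-value v q N≤q Pq≡¬v b with A₀-pair (q * 2 ^ b) v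
  ... | a , a/2≡t , A₀a≡v = a , b≤a , A≡true , A₀a≡v
    where
    q≤t : q ≤ q * 2 ^ b
    q≤t = m≤m*n q (2 ^ b) {{m^n≢0 2 b}}
    b≤a : b ≤ a
    b≤a = begin
      b               ≤⟨ <⇒≤ (n<2^n b) ⟩
      2 ^ b           ≤⟨ m≤n*m (2 ^ b) q {{>-nonZero (≤-trans (s≤s z≤n) N≤q)}} ⟩
      q * 2 ^ b       ≡⟨ a/2≡t ⟨
      a / 2           ≤⟨ m/n≤m a 2 ⟩
      a               ∎
      where open ≤-Reasoning
    A≡true : A a ≡ true
    A≡true = begin
      A a                 ≡⟨ A-via-half a (subst (N ≤_) (sym a/2≡t) (≤-trans N≤q q≤t)) ⟩
      A₀ a xor P (a / 2)  ≡⟨ cong₂ _xor_ A₀a≡v (trans (cong P a/2≡t) (startsWith-*2^ p q (N≤⇒p<*2 N≤q) b)) ⟩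
      v xor P q           ≡⟨ cong (v xor_) Pq≡¬v ⟩
      v xor not v         ≡⟨ xor-inverseʳ v ⟩
      true                ∎
      where open ≡-Reasoning

  A∩A₀-unbounded : ∀ b → Σ ℕ λ a → b ≤ a × (A a ∧ A₀ a) ≡ true
  A∩A₀-unbounded b with A-unbounded-with-A₀-value true (m * 2) N≤m*2 (P-below (m * 2) ≤-refl) b
  ... | a , b≤a , Aa≡true , A₀a≡true = a , b≤a , cong₂ _∧_ Aa≡true A₀a≡true

  A∩B₀-unbounded : ∀ b → Σ ℕ λ a → b ≤ a × (A a ∧ B₀ a) ≡ true
  A∩B₀-unbounded b with A-unbounded-with-A₀-value false p N≤p P-p b
  ... | a , b≤a , Aa≡true , A₀a≡false = a , b≤a , cong₂ (λ u v → u ∧ not v) Aa≡true A₀a≡false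

  Q : ℕ → Bool
  Q a = P a ∧ not (A₀ a)

  count-P-below : ∀ x → x ≤ p → count P x ≡ 0
  count-P-below x x≤p = count-none P x (λ a a<x → P-below a (<-≤-trans a<x x≤p))

  count-P-2N : count P (N * 2) ≡ 1
  count-P-2N = cong₂ _+_ (count-P-below p ≤-refl) (cong toℕ P-p)

  count-P-double : ∀ y → N ≤ y → count P (y * 2) ≡ count P y * 2 + 1
  count-P-double _ N≤y = from-2N (≤⇒≤′ N≤y)
    where
    from-2N : ∀ {y} → N ≤′ y → count P (y * 2) ≡ count P y * 2 + 1
    from-2N ≤′-refl = trans count-P-2N (cong (λ c → c * 2 + 1) (sym (count-P-below N N≤p)))
    from-2N (≤′-step {y} N≤′y) = begin
      count P (suc y * 2)                                        ≡⟨ count-pairs P y ⟩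
      count P (y * 2) + (toℕ (P (y * 2)) + toℕ (P (suc (y * 2))))
        ≡⟨ cong₂ (λ c u → c + (toℕ u + toℕ (P (suc (y * 2))))) (from-2N N≤′y) (P-double y (≤′⇒≤ N≤′y)) ⟩
      count P y * 2 + 1 + (toℕ (P y) + toℕ (P (suc (y * 2))))
        ≡⟨ cong (λ u → count P y * 2 + 1 + (toℕ (P y) + toℕ u)) (P-double+1 y (≤′⇒≤ N≤′y)) ⟩
      count P y * 2 + 1 + (toℕ (P y) + toℕ (P y))
        ≡⟨ regroup (count P y) (toℕ (P y)) ⟩
      count P (suc y) * 2 + 1 ∎
      where
      open ≡-Reasoning
      regroup : ∀ c i → c * 2 + 1 + (i + i) ≡ (c + i) * 2 + 1
      regroup = solve-∀

  count-Q-double : ∀ y → N ≤ y → count Q (y * 2) ≤ count P y + 1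
  count-Q-double _ N≤y = from-2N (≤⇒≤′ N≤y)
    where
    from-2N : ∀ {y} → N ≤′ y → count Q (y * 2) ≤ count P y + 1
    from-2N ≤′-refl = begin
      count Q (N * 2)  ≤⟨ count-mono (N * 2) (λ a _ → Q⇒P (P a)) ⟩
      count P (N * 2)  ≡⟨ count-P-2N ⟩
      1                ≡⟨ cong (_+ 1) (count-P-below N N≤p) ⟨
      count P N + 1    ∎
      where
      open ≤-Reasoning
      Q⇒P : ∀ {x} u → T (u ∧ x) → T u
      Q⇒P true _ = _
    from-2N (≤′-step {y} N≤′y) = begin
      count Q (suc y * 2)                                          ≡⟨ count-pairs Q y ⟩
      count Q (y * 2) + (toℕ (Q (y * 2)) + toℕ (Q (suc (y * 2))))  ≡⟨ cong (count Q (y * 2) +_) Q-pair ⟩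
      count Q (y * 2) + toℕ (P y)                                  ≤⟨ +-monoˡ-≤ (toℕ (P y)) (from-2N N≤′y) ⟩
      count P y + 1 + toℕ (P y)                                    ≡⟨ +-assoc (count P y) 1 _ ⟩
      count P y + (1 + toℕ (P y))                                  ≡⟨ cong (count P y +_) (+-comm 1 (toℕ (P y))) ⟩
      count P y + (toℕ (P y) + 1)                                  ≡⟨ +-assoc (count P y) _ 1 ⟨
      count P (suc y) + 1                                          ∎
      where
      open ≤-Reasoning
      one-of-two : ∀ x u → toℕ (u ∧ not x) + toℕ (u ∧ not (not x)) ≡ toℕ u
      one-of-two true  true  = refl
      one-of-two false true  = refl
      one-of-two _     false = refl
      Q-pair : toℕ (Q (y * 2)) + toℕ (Q (suc (y * 2))) ≡ toℕ (P y)
      Q-pair = trans (cong₂ (λ u v → toℕ (u ∧ not (A₀ (y * 2))) + toℕ (v ∧ not (A₀ (suc (y * 2)))))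
                                (P-double y (≤′⇒≤ N≤′y)) (P-double+1 y (≤′⇒≤ N≤′y)))
                     (trans (cong₂ (λ u v → toℕ (P y ∧ not u) + toℕ (P y ∧ not v)) (A₀-double y) (A₀-double+1 y))
                            (one-of-two (A₀ y) (P y)))

  count-P-2^-upper : ∀ j → N ≤ 2 ^ j → N * (count P (2 ^ j) + 1) ≤ 2 ^ j
  count-P-2^-upper zero    (s≤s ())
  count-P-2^-upper (suc j) N≤2^1+j with N ≤? 2 ^ j
  ... | yes N≤2^j = begin
    N * (count P (2 * 2 ^ j) + 1)     ≡⟨ cong (λ y → N * (count P y + 1)) (*-comm 2 (2 ^ j)) ⟩
    N * (count P (2 ^ j * 2) + 1)     ≡⟨ cong (λ c → N * (c + 1)) (count-P-double (2 ^ j) N≤2^j) ⟩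
    N * (count P (2 ^ j) * 2 + 1 + 1) ≡⟨ regroup N (count P (2 ^ j)) ⟩
    N * (count P (2 ^ j) + 1) * 2     ≤⟨ *-monoˡ-≤ 2 (count-P-2^-upper j N≤2^j) ⟩
    2 ^ j * 2                         ≡⟨ *-comm (2 ^ j) 2 ⟩
    2 * 2 ^ j                         ∎
    where
    open ≤-Reasoning
    regroup : ∀ n c → n * (c * 2 + 1 + 1) ≡ n * (c + 1) * 2
    regroup = solve-∀
  ... | no N≰2^j = begin
    N * (count P (2 * 2 ^ j) + 1)     ≡⟨ cong (λ c → N * (c + 1)) (count-P-below (2 * 2 ^ j) 2^1+j≤p) ⟩
    N * 1                             ≡⟨ *-identityʳ N ⟩
    N                                 ≤⟨ N≤2^1+j ⟩
    2 * 2 ^ j                         ∎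
    where
    open ≤-Reasoning
    2^1+j≤p : 2 * 2 ^ j ≤ p
    2^1+j≤p = ≤-trans (≤-reflexive (*-comm 2 (2 ^ j))) (m≤n⇒m≤1+n (*-monoˡ-≤ 2 (≤-pred (≰⇒> N≰2^j))))

  count-P-2^-lower : ∀ j → j ≤ count P (2 ^ j) + N
  count-P-2^-lower zero    = z≤n
  count-P-2^-lower (suc j) with N ≤? 2 ^ j
  ... | yes N≤2^j = begin
    suc j                          ≤⟨ s≤s (count-P-2^-lower j) ⟩
    suc (count P (2 ^ j)) + N      ≡⟨ cong (_+ N) (+-comm 1 (count P (2 ^ j))) ⟩
    count P (2 ^ j) + 1 + N        ≤⟨ +-monoˡ-≤ N (+-monoˡ-≤ 1 (m≤m*n (count P (2 ^ j)) 2)) ⟩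
    count P (2 ^ j) * 2 + 1 + N    ≡⟨ cong (_+ N) (count-P-double (2 ^ j) N≤2^j) ⟨
    count P (2 ^ j * 2) + N        ≡⟨ cong (λ y → count P y + N) (*-comm (2 ^ j) 2) ⟩
    count P (2 * 2 ^ j) + N        ∎
    where open ≤-Reasoning
  ... | no N≰2^j = ≤-trans (n<2^n j) (≤-trans (<⇒≤ (≰⇒> N≰2^j)) (m≤n+m N _))

  Q′ : ℕ → Bool
  Q′ a = (a <ᵇ 2) ∨ Q a

  A-pairs-meet-Q′ : ∀ x n → suc n ≡ 2 ^ suc (x * 2) →
                    ∀ a → a + a < n → T (A a) → T (A (n ∸ a)) → T (Q′ a) ⊎ T (Q′ (n ∸ a))
  A-pairs-meet-Q′ x n 1+n≡2^ a a+a<n Aa An-a with a <? 2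
  ... | yes a<2 = inj₁ (Equivalence.from T-∨ (inj₁ (<⇒<ᵇ a<2)))
  ... | no  a≮2 = Sum.map (Equivalence.from T-∨ ∘ inj₂) (Equivalence.from T-∨ ∘ inj₂)
                    (xor-cover (A₀-complement x a (n ∸ a) (trans (cong suc (m+[n∸m]≡n a≤n)) 1+n≡2^))
                               (subst T (A-≥2 a 2≤a) Aa) (subst T (A-≥2 (n ∸ a) 2≤n-a) An-a))
    where
    a≤n : a ≤ n
    a≤n = ≤-trans (m≤m+n a a) (<⇒≤ a+a<n)
    2≤a : 2 ≤ a
    2≤a = ≮⇒≥ a≮2
    2≤n-a : 2 ≤ n ∸ a
    2≤n-a = ≤-trans 2≤a (<⇒≤ (+-cancelˡ-< a a (n ∸ a) (subst (a + a <_) (sym (m+[n∸m]≡n a≤n)) a+a<n)))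
    xor-cover : ∀ {x y u v} → y ≡ not x → T (x xor u) → T (y xor v) → T (u ∧ not x) ⊎ T (v ∧ not y)
    xor-cover {true}  {_} {false} {true}  refl _ _ = inj₂ _
    xor-cover {false} {_} {true}  {_}     refl _ _ = inj₁ _
    xor-cover {true}  {_} {true}  {_}     refl () _
    xor-cover {true}  {_} {false} {false} refl _ ()
    xor-cover {false} {_} {false} {_}     refl () _

  R₂-A-≤ : ∀ x n → suc n ≡ 2 ^ suc (x * 2) → N ≤ 2 ^ (x * 2) → R₂ A n ≤ 2 + (count P (2 ^ (x * 2)) + 1)
  R₂-A-≤ x n 1+n≡2^ N≤Y = begin
    R₂ A n                                   ≤⟨ Halves.R₂-≤-cover n A Q′ (A-pairs-meet-Q′ x n 1+n≡2^) ⟩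
    count Q′ (suc n)                         ≤⟨ count-∨ (_<ᵇ 2) Q (suc n) ⟩
    count (_<ᵇ 2) (suc n) + count Q (suc n)  ≤⟨ +-mono-≤ (count-<2 (suc n)) (≤-reflexive (cong (count Q) 1+n≡Y*2)) ⟩
    2 + count Q (Y * 2)                      ≤⟨ +-monoʳ-≤ 2 (count-Q-double Y N≤Y) ⟩
    2 + (count P Y + 1)                      ∎
    where
    open ≤-Reasoning
    Y : ℕ
    Y = 2 ^ (x * 2)
    1+n≡Y*2 : suc n ≡ Y * 2
    1+n≡Y*2 = trans 1+n≡2^ (*-comm 2 Y)

  R₂-A-sparse : ∀ b → Σ ℕ λ n → b ≤ n × 2 * m * R₂ A n < n + 1
  R₂-A-sparse b = n , b≤n , 2mR<n+1
    where
    -- K is even, so A₀ separates each a ≤ n from n ∸ a; it is large enough that m * 2 ≤ count P Y.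
    x K Y n : ℕ
    x = b + N + N
    K = x * 2
    Y = 2 ^ K
    n = 2 ^ suc K ∸ 1

    1+n≡2^1+K : suc n ≡ 2 ^ suc K
    1+n≡2^1+K = trans (+-comm 1 n) (m∸n+n≡m (m^n>0 2 (suc K)))
    K-split : K ≡ m * 2 + N + (b * 2 + N + 2)
    K-split = split b m
      where
      split : ∀ b m → (b + suc m + suc m) * 2 ≡ m * 2 + suc m + (b * 2 + suc m + 2)
      split = solve-∀
    m*2+N≤K : m * 2 + N ≤ K
    m*2+N≤K = ≤-trans (m≤m+n _ _) (≤-reflexive (sym K-split))
    N≤Y : N ≤ Y
    N≤Y = ≤-trans (≤-trans (m≤n+m N (m * 2)) m*2+N≤K) (<⇒≤ (n<2^n K))
    b≤n : b ≤ n
    b≤n = ≤-pred (begin-strict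
      b          ≤⟨ ≤-trans (≤-trans (m≤m+n b N) (m≤m+n (b + N) N)) (m≤m*n x 2) ⟩
      K          <⟨ n<2^n K ⟩
      2 ^ K      <⟨ ^-monoʳ-< 2 (s≤s (s≤s z≤n)) (n<1+n K) ⟩
      2 ^ suc K  ≡⟨ 1+n≡2^1+K ⟨
      suc n      ∎)
      where open ≤-Reasoning
    2m≤count : m * 2 ≤ count P Y
    2m≤count = +-cancelʳ-≤ N (m * 2) (count P Y) (≤-trans m*2+N≤K (count-P-2^-lower K))
    2mR<n+1 : 2 * m * R₂ A n < n + 1
    2mR<n+1 = begin-strict
      2 * m * R₂ A n                 ≤⟨ *-monoʳ-≤ (2 * m) (R₂-A-≤ x n 1+n≡2^1+K N≤Y) ⟩
      2 * m * (2 + (count P Y + 1))  <⟨ 2m[c+3]<2[m+1][c+1] m (count P Y) 2m≤count ⟩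
      N * (count P Y + 1) * 2        ≤⟨ *-monoˡ-≤ 2 (count-P-2^-upper K N≤Y) ⟩
      Y * 2                          ≡⟨ trans 1+n≡2^1+K (*-comm 2 Y) ⟨
      suc n                          ≡⟨ +-comm 1 n ⟩
      n + 1                          ∎
      where open ≤-Reasoning

corollary1 : (N : ℕ) → 3 ≤ N →
  Σ Subset (λ A →
    ((n : ℕ) → 2 * N ∸ 1 ≤ n → R₂ A n ≡ R₂ (compl A) n)
    × ((m : ℕ) → Σ ℕ (λ a → m ≤ a × (A a ∧ A₀ a) ≡ true))
    × ((m : ℕ) → Σ ℕ (λ a → m ≤ a × (A a ∧ B₀ a) ≡ true))
    × ((m : ℕ) → Σ ℕ (λ n → m ≤ n × 2 * (N ∸ 1) * R₂ A n < n + 1)))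
corollary1 zero                   ()
corollary1 (suc zero)             (s≤s ())
corollary1 (suc (suc zero))       (s≤s (s≤s ()))
corollary1 (suc (suc (suc k)))    _ =
  A , R₂-A-compl , A∩A₀-unbounded , A∩B₀-unbounded , R₂-A-sparse
  where open Construction (suc k)
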